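{- For all integers $n\ge1$ and $k\ge1$, $$|\overline{\mathcal{Q}}^k_n|=\frac{(kn)!}{((k-1)n+1)!}=n!\,C_{n,k},\qquad\text{where } C_{n,k}=\frac{1}{(k-1)n+1}\binom{kn}{n}.$$
   Context: $\overline{\mathcal{Q}}^k_n$ is the set of permutations of the multiset $\{1^k,2^k,\dots,n^k\}$ ($k$ copies of each $i\in[n]$) that avoid the patterns $1212$ and $2121$, i.e. have no indices $i<j<l<m$ with $\pi_i=\pi_l$, $\pi_j=\pi_m$ and $\pi_i\ne\pi_j$. -}

module Defs where

open import Data.Nat using (ℕ; suc; _*_; _<_)
open import Data.Fin using (Fin) renaming (_<_ to _<ᶠ_)
open import Data.Fin.Properties using (_≟_)
open import Data.Vec using (Vec; lookup; count)
open import Data.Product using (∃; _×_; ∃-syntax)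
open import Relation.Binary.PropositionalEquality using (_≡_; _≢_)
open import Relation.Nullary using (¬_)

Word : ℕ → ℕ → Set
Word n k = Vec (Fin n) (k * n)

occ : ∀ {n L} → Fin n → Vec (Fin n) L → ℕ
occ i w = count (_≟ i) w

IsMultisetPerm : ∀ n k → Word n k → Set
IsMultisetPerm n k w = ∀ (i : Fin n) → occ i w ≡ k

Contains1212or2121 : ∀ {n L} → Vec (Fin n) L → Set
Contains1212or2121 {n} {L} w =
  ∃[ a ] ∃[ b ] ∃[ c ] ∃[ d ]
    (a <ᶠ b × b <ᶠ c × c <ᶠ d ×
     lookup w a ≡ lookup w c × lookup w b ≡ lookup w d × lookup w a ≢ lookup w b)

InQbar : ∀ n k → Word n k → Set
InQbar n k w = IsMultisetPerm n k w × ¬ Contains1212or2121 w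

module Submission where

-- A word with k copies of each letter avoids 1212 and 2121 exactly when it obeys a stack discipline:
-- read from left to right, every letter is either used for the first time or is the last written
-- letter that still has copies to come.  Indeed, if x is followed by a new y before x is finished,
-- y must be finished before x returns, or x y x y appears.  So the admissible continuations of a
-- prefix depend only on the number u of unused letters and the number r of copies owed by used
-- letters, and their number c(m, u, r) of length m satisfies
--   c(m + 1, u, r) = u · c(m, u − 1, r + k − 1) + [r > 0] · c(m, u, r − 1).
-- Along m = ku + r this is solved by c · ((k − 1)u + r + 1)! = (r + 1) · (ku + r)!, which at u = n,
-- r = 0 is the claimed count (kn)!/((k − 1)n + 1)! = n! C(kn, n)/((k − 1)n + 1).

open import Defs
open import Data.Nat using (ℕ; _*_; _+_; _∸_; _≥_; _!)
open import Data.Nat.Combinatorics using (_C_)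
open import Data.List using (List; length)
open import Data.List.Relation.Unary.Unique.Propositional using (Unique)
open import Data.List.Membership.Propositional using (_∈_)
open import Data.Product using (∃; _×_; ∃-syntax)
open import Function.Bundles using (_⇔_)
open import Relation.Binary.PropositionalEquality using (_≡_)

open import Data.Bool using (if_then_else_; true; false)
open import Data.Empty using (⊥-elim)
open import Data.Fin using (Fin; zero; suc) renaming (_<_ to _<ᶠ_)
import Data.Fin.Properties as Fin
open import Data.List using ([]; _∷_; _++_; [_]; map; filter; concatMap; allFin; tabulate; fromMaybe)
open import Data.List.Properties
  using (∷-injectiveʳ; ++-assoc; ++-identityʳ; concatMap-++; length-map; length-++
        ; filter-++; filter-accept; filter-reject)
open import Data.List.Membership.Propositional using (_∉_; find; lose)
open import Data.List.Membership.Propositional.Properties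
  using (∈-++⁺ˡ; ∈-++⁺ʳ; ∈-++⁻; ∈-∃++; ∈-allFin; ∈-filter⁺; ∈-filter⁻; ∈-map⁺; ∈-map⁻; ∈-concatMap⁺; ∈-concatMap⁻)
open import Data.List.Relation.Binary.Disjoint.Propositional using (Disjoint)
open import Data.List.Relation.Unary.All using (All; []; _∷_)
import Data.List.Relation.Unary.All as All
import Data.List.Relation.Unary.All.Properties as All
open import Data.List.Relation.Unary.AllPairs using ([]; _∷_)
import Data.List.Relation.Unary.AllPairs as AllPairs
import Data.List.Relation.Unary.AllPairs.Properties as AllPairs
open import Data.List.Relation.Unary.Any using (here; there)
import Data.List.Relation.Unary.Unique.Propositional.Properties as Unique
open import Data.Maybe using (Maybe; just; nothing)
open import Data.Nat using (zero; suc; pred; _≤_; _<_; z≤n; s≤s; s≤s⁻¹)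
open import Data.Nat.Combinatorics using (nCk≡n!/k![n-k]!; k![n∸k]!∣n!)
open import Data.Nat.DivMod using (m*[n/m]≡n)
open import Data.Nat.Properties
  using ( +-assoc; +-comm; +-identityʳ; +-suc; +-cancelˡ-≡; +-cancelʳ-≡; m+n≡0⇒m≡0; m+n≡0⇒n≡0
        ; *-assoc; *-identityˡ; *-identityʳ; *-zeroʳ; *-cancelʳ-≡
        ; n∸n≡0; m∸n≡0⇒m≤n; +-∸-assoc; m+n∸m≡n; m≤m+n; ≤-antisym; ≤∧≢⇒<; suc-injective; _!≢0; _!*_!≢0)
import Data.Nat.Properties as ℕ
open import Algebra.Properties.Monoid.Sum ℕ.+-0-monoid using (sum-syntax; sum-cong-≗)
open import Data.Nat.Tactic.RingSolver using (solve-∀)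
open import Data.Product using (∃₂; _,_; proj₂)
open import Data.Sum using (_⊎_; inj₁; inj₂)
open import Data.Vec using (Vec; toList; lookup; count)
import Data.Vec as Vec
import Data.Vec.Properties as Vec
open import Function using (_∘_)
open import Function.Bundles using (mk⇔)
open import Function.Properties.Equivalence using () renaming (trans to ⇔-trans; sym to ⇔-sym)
open import Relation.Binary.Definitions using (DecidableEquality)
open import Relation.Binary.PropositionalEquality using (_≢_; refl; sym; trans; cong; cong₂; subst; module ≡-Reasoning)
open import Relation.Nullary using (¬_; ¬?; Dec; does; yes; no)
open import Relation.Nullary.Decidable using (decidable-stable)
open import Relation.Unary using (Decidable; ∁)

module _ {A : Set} where

  first-occurrence : DecidableEquality A → ∀ xs {x : A} ys →
                     ∃₂ λ s c → xs ++ x ∷ ys ≡ s ++ x ∷ c ++ ys × x ∉ s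
  first-occurrence _≟_ [] ys = [] , [] , refl , λ ()
  first-occurrence _≟_ (z ∷ xs) {x} ys with z ≟ x
  ... | yes refl = [] , xs ++ [ x ] , cong (x ∷_) (sym (++-assoc xs [ x ] ys)) , λ ()
  ... | no z≢x =
    let s , c , eq , x∉s = first-occurrence _≟_ xs ys
    in z ∷ s , c , cong (z ∷_) eq , λ { (here x≡z) → z≢x (sym x≡z) ; (there x∈s) → x∉s x∈s }

  occurrence-before-suffix : ∀ {x : A} xs {m} s {t} → x ∉ m → xs ++ m ≡ s ++ x ∷ t → ∃ λ c → t ≡ c ++ m
  occurrence-before-suffix []       s       x∉m refl = ⊥-elim (x∉m (∈-++⁺ʳ s (here refl)))
  occurrence-before-suffix (z ∷ xs) []      x∉m refl = xs , refl
  occurrence-before-suffix (z ∷ xs) (_ ∷ s) x∉m eq   = occurrence-before-suffix xs s x∉m (∷-injectiveʳ eq)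

  findLast : {P : A → Set} → Decidable P → List A → Maybe A
  findLast P? [] = nothing
  findLast P? (x ∷ xs) with findLast P? xs
  ... | just y  = just y
  ... | nothing = if does (P? x) then just x else nothing

  module _ {P : A → Set} (P? : Decidable P) where

    findLast-nothing : ∀ {xs} → findLast P? xs ≡ nothing → All (∁ P) xs
    findLast-nothing {[]} _ = []
    findLast-nothing {x ∷ xs} eq with findLast P? xs in eq′
    findLast-nothing {x ∷ xs} eq | nothing with P? x
    findLast-nothing {x ∷ xs} () | nothing | yes _
    findLast-nothing {x ∷ xs} eq | nothing | no ¬px = ¬px ∷ findLast-nothing eq′

    findLast-just : ∀ {xs x} → findLast P? xs ≡ just x → ∃₂ λ s t → xs ≡ s ++ x ∷ t × P x × All (∁ P) t
    findLast-just {z ∷ xs} eq with findLast P? xs in eq′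
    findLast-just {z ∷ xs} refl | just y =
      let s , t , xs≡ , py , ¬pt = findLast-just eq′ in z ∷ s , t , cong (z ∷_) xs≡ , py , ¬pt
    findLast-just {z ∷ xs} eq | nothing with P? z
    findLast-just {z ∷ xs} refl | nothing | yes pz = [] , xs , refl , pz , findLast-nothing eq′
    findLast-just {z ∷ xs} () | nothing | no _

  ∈-fromMaybe⁻ : ∀ {x : A} {mx} → x ∈ fromMaybe mx → mx ≡ just x
  ∈-fromMaybe⁻ {mx = just _} (here refl) = refl

  fromMaybe-unique : (mx : Maybe A) → Unique (fromMaybe mx)
  fromMaybe-unique (just _) = [] ∷ []
  fromMaybe-unique nothing  = []

  data HasABAB (W : List A) : Set where
    abab : ∀ {x y} p₁ p₂ p₃ p₄ p₅ → x ≢ y → W ≡ p₁ ++ x ∷ p₂ ++ y ∷ p₃ ++ x ∷ p₄ ++ y ∷ p₅ → HasABAB W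

module Occurrences {A : Set} (_≟_ : DecidableEquality A) where

  occurrences : A → List A → ℕ
  occurrences x xs = length (filter (_≟ x) xs)

  occurrences-++ : ∀ x xs ys → occurrences x (xs ++ ys) ≡ occurrences x xs + occurrences x ys
  occurrences-++ x xs ys = trans (cong length (filter-++ (_≟ x) xs ys)) (length-++ (filter (_≟ x) xs))

  occurrences-snoc-self : ∀ x xs → occurrences x (xs ++ [ x ]) ≡ suc (occurrences x xs)
  occurrences-snoc-self x xs = begin
    occurrences x (xs ++ [ x ])           ≡⟨ occurrences-++ x xs [ x ] ⟩
    occurrences x xs + occurrences x [ x ] ≡⟨ cong (λ c → occurrences x xs + length c) (filter-accept (_≟ x) refl) ⟩
    occurrences x xs + 1                   ≡⟨ +-comm _ 1 ⟩
    suc (occurrences x xs)                 ∎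
    where open ≡-Reasoning

  occurrences-snoc-other : ∀ {x y} xs → y ≢ x → occurrences x (xs ++ [ y ]) ≡ occurrences x xs
  occurrences-snoc-other {x} {y} xs y≢x = begin
    occurrences x (xs ++ [ y ])           ≡⟨ occurrences-++ x xs [ y ] ⟩
    occurrences x xs + occurrences x [ y ] ≡⟨ cong (λ c → occurrences x xs + length c) (filter-reject (_≟ x) y≢x) ⟩
    occurrences x xs + 0                   ≡⟨ +-identityʳ _ ⟩
    occurrences x xs                       ∎
    where open ≡-Reasoning

  ∈⇒occurrences≢0 : ∀ {x xs} → x ∈ xs → occurrences x xs ≢ 0
  ∈⇒occurrences≢0 {x} x∈xs = nonempty (∈-filter⁺ (_≟ x) x∈xs refl)
    where
    nonempty : ∀ {l} → x ∈ l → length l ≢ 0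
    nonempty (here _)  ()
    nonempty (there _) ()

  occurrences≢0⇒∈ : ∀ {x} xs → occurrences x xs ≢ 0 → x ∈ xs
  occurrences≢0⇒∈ {x} xs occ≢0 with filter (_≟ x) xs in eq
  ... | []    = ⊥-elim (occ≢0 refl)
  ... | y ∷ _ = let y∈xs , y≡x = ∈-filter⁻ (_≟ x) (subst (y ∈_) (sym eq) (here refl)) in subst (_∈ xs) y≡x y∈xs

count≡length∘filter : ∀ {A : Set} {P : A → Set} (P? : Decidable P) {m} (v : Vec A m) →
                      count P? v ≡ length (filter P? (toList v))
count≡length∘filter P? Vec.[] = refl
count≡length∘filter P? (x Vec.∷ v) with does (P? x)
... | true  = cong suc (count≡length∘filter P? v)
... | false = count≡length∘filter P? v

module _ {A : Set} where

  prefix : ∀ {m} → Vec A m → Fin m → List A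
  prefix (x Vec.∷ v) zero    = []
  prefix (x Vec.∷ v) (suc i) = x ∷ prefix v i

  suffix : ∀ {m} → Vec A m → Fin m → List A
  suffix (x Vec.∷ v) zero    = toList v
  suffix (x Vec.∷ v) (suc i) = suffix v i

  toList-split : ∀ {m} (v : Vec A m) i → toList v ≡ prefix v i ++ lookup v i ∷ suffix v i
  toList-split (x Vec.∷ v) zero    = refl
  toList-split (x Vec.∷ v) (suc i) = cong (x ∷_) (toList-split v i)

  suffix-split : ∀ {m} (v : Vec A m) {i j} → i <ᶠ j → ∃ λ mid → suffix v i ≡ mid ++ lookup v j ∷ suffix v j
  suffix-split (x Vec.∷ v) {zero}  {suc j} _         = prefix v j , toList-split v j
  suffix-split (x Vec.∷ v) {suc i} {suc j} (s≤s i<j) = suffix-split v i<j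

  first-position : ∀ {m} (v : Vec A m) {p z q} → toList v ≡ p ++ z ∷ q →
                   ∃ λ i → lookup v i ≡ z × suffix v i ≡ q
  first-position (x Vec.∷ v) {[]}    refl = zero , refl , refl
  first-position (x Vec.∷ v) {_ ∷ p} eq   =
    let i , vᵢ≡z , sᵢ≡q = first-position v (∷-injectiveʳ eq) in suc i , vᵢ≡z , sᵢ≡q

  later-position : ∀ {m} (v : Vec A m) i {p z q} → suffix v i ≡ p ++ z ∷ q →
                   ∃ λ j → i <ᶠ j × lookup v j ≡ z × suffix v j ≡ q
  later-position (x Vec.∷ v) zero eq =
    let j , vⱼ≡z , sⱼ≡q = first-position v eq in suc j , s≤s z≤n , vⱼ≡z , sⱼ≡q
  later-position (x Vec.∷ v) (suc i) eq =
    let j , i<j , vⱼ≡z , sⱼ≡q = later-position v i eq in suc j , s≤s i<j , vⱼ≡z , sⱼ≡q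

contains⇒hasABAB : ∀ {n L} (v : Vec (Fin n) L) → Contains1212or2121 v → HasABAB (toList v)
contains⇒hasABAB v (a , b , c , d , a<b , b<c , c<d , va≡vc , vb≡vd , va≢vb)
  with m₂ , sa ← suffix-split v a<b | m₃ , sb ← suffix-split v b<c | m₄ , sc ← suffix-split v c<d =
  abab (prefix v a) m₂ m₃ m₄ (suffix v d) va≢vb
       (trans (toList-split v a) (cong (λ s → prefix v a ++ lookup v a ∷ s) after-a))
  where
  open ≡-Reasoning
  after-a : suffix v a ≡ m₂ ++ lookup v b ∷ m₃ ++ lookup v a ∷ m₄ ++ lookup v b ∷ suffix v d
  after-a = begin
    suffix v a
      ≡⟨ sa ⟩
    m₂ ++ lookup v b ∷ suffix v b
      ≡⟨ cong (λ s → m₂ ++ lookup v b ∷ s) sb ⟩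
    m₂ ++ lookup v b ∷ m₃ ++ lookup v c ∷ suffix v c
      ≡⟨ cong (λ s → m₂ ++ lookup v b ∷ m₃ ++ lookup v c ∷ s) sc ⟩
    m₂ ++ lookup v b ∷ m₃ ++ lookup v c ∷ m₄ ++ lookup v d ∷ suffix v d
      ≡⟨ cong₂ (λ y z → m₂ ++ lookup v b ∷ m₃ ++ y ∷ m₄ ++ z ∷ suffix v d) (sym va≡vc) (sym vb≡vd) ⟩
    m₂ ++ lookup v b ∷ m₃ ++ lookup v a ∷ m₄ ++ lookup v b ∷ suffix v d ∎

hasABAB⇒contains : ∀ {n L} (v : Vec (Fin n) L) → HasABAB (toList v) → Contains1212or2121 v
hasABAB⇒contains v (abab p₁ p₂ p₃ p₄ p₅ x≢y eq) =
  let a , va≡x , sa = first-position v eq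
      b , a<b , vb≡y , sb = later-position v a sa
      c , b<c , vc≡x , sc = later-position v b sb
      d , c<d , vd≡y , _ = later-position v c sc
  in a , b , c , d , a<b , b<c , c<d , trans va≡x (sym vc≡x) , trans vb≡y (sym vd≡y) ,
     λ va≡vb → x≢y (trans (sym va≡x) (trans va≡vb vb≡y))

module _ {A : Set} {m : ℕ} where

  prefixed : (A → List (Vec A m)) → List A → List (Vec A (suc m))
  prefixed g = concatMap (λ x → map (x Vec.∷_) (g x))

  ∈-prefixed⁻ : ∀ g xs {x v} → (x Vec.∷ v) ∈ prefixed g xs → x ∈ xs × v ∈ g x
  ∈-prefixed⁻ g xs x∷v∈ with y , y∈xs , x∷v∈map ← find (∈-concatMap⁻ (λ x → map (x Vec.∷_) (g x)) {xs = xs} x∷v∈)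
    with v′ , v′∈ , refl ← ∈-map⁻ (y Vec.∷_) x∷v∈map = y∈xs , v′∈

  ∈-prefixed⁺ : ∀ g {xs x v} → x ∈ xs → v ∈ g x → (x Vec.∷ v) ∈ prefixed g xs
  ∈-prefixed⁺ g x∈xs v∈ = ∈-concatMap⁺ (λ x → map (x Vec.∷_) (g x)) (lose x∈xs (∈-map⁺ (_ Vec.∷_) v∈))

  prefixed-unique : ∀ g {xs} → Unique xs → (∀ x → Unique (g x)) → Unique (prefixed g xs)
  prefixed-unique g xs! g! =
    Unique.concat⁺ (All.map⁺ (All.universal (λ x → Unique.map⁺ Vec.∷-injectiveʳ (g! x)) _))
                   (AllPairs.map⁺ (AllPairs.map disjoint xs!))
    where
    disjoint : ∀ {x y} → x ≢ y → Disjoint (map (x Vec.∷_) (g x)) (map (y Vec.∷_) (g y))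
    disjoint x≢y (v∈ , v∈′) with _ , _ , refl ← ∈-map⁻ _ v∈ | _ , _ , eq ← ∈-map⁻ _ v∈′ = x≢y (Vec.∷-injectiveˡ eq)

  length-prefixed : ∀ g xs {c} → (∀ {x} → x ∈ xs → length (g x) ≡ c) → length (prefixed g xs) ≡ length xs * c
  length-prefixed g []       _      = refl
  length-prefixed g (x ∷ xs) {c} same-c = begin
    length (map (x Vec.∷_) (g x) ++ prefixed g xs)
      ≡⟨ length-++ (map (x Vec.∷_) (g x)) ⟩
    length (map (x Vec.∷_) (g x)) + length (prefixed g xs)
      ≡⟨ cong₂ _+_ (trans (length-map _ (g x)) (same-c (here refl))) (length-prefixed g xs (same-c ∘ there)) ⟩
    c + length xs * c ∎
    where open ≡-Reasoning

∑-const : ∀ n c → ∑[ i < n ] c ≡ n * c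
∑-const zero    c = refl
∑-const (suc n) c = cong (c +_) (∑-const n c)

∑-zero : ∀ {n} (f : Fin n → ℕ) → (∀ i → f i ≡ 0) → ∑[ i < n ] f i ≡ 0
∑-zero {n} f f≡0 = trans (sum-cong-≗ f≡0) (trans (∑-const n 0) (*-zeroʳ n))

∑≡0⇒≡0 : ∀ {n} (f : Fin n → ℕ) → ∑[ i < n ] f i ≡ 0 → ∀ i → f i ≡ 0
∑≡0⇒≡0 f ∑≡0 zero    = m+n≡0⇒m≡0 (f zero) ∑≡0
∑≡0⇒≡0 f ∑≡0 (suc i) = ∑≡0⇒≡0 (f ∘ suc) (m+n≡0⇒n≡0 (f zero) ∑≡0) i

∑-update : ∀ {n} (f g : Fin n → ℕ) x → (∀ i → i ≢ x → f i ≡ g i) →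
           ∑[ i < n ] f i + g x ≡ ∑[ i < n ] g i + f x
∑-update f g zero f≡g = begin
  f zero + ∑[ i < _ ] f (suc i) + g zero ≡⟨ cong (λ s → f zero + s + g zero) (sum-cong-≗ (λ i → f≡g (suc i) λ ())) ⟩
  f zero + ∑[ i < _ ] g (suc i) + g zero ≡⟨ swap-outer (f zero) _ (g zero) ⟩
  g zero + ∑[ i < _ ] g (suc i) + f zero ∎
  where
  open ≡-Reasoning
  swap-outer : ∀ a b c → a + b + c ≡ c + b + a
  swap-outer = solve-∀
∑-update f g (suc x) f≡g = begin
  f zero + ∑[ i < _ ] f (suc i) + g (suc x)   ≡⟨ +-assoc (f zero) _ _ ⟩
  f zero + (∑[ i < _ ] f (suc i) + g (suc x)) ≡⟨ cong₂ _+_ (f≡g zero λ ())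
                                                          (∑-update (f ∘ suc) (g ∘ suc) x
                                                             (λ i i≢x → f≡g (suc i) (i≢x ∘ Fin.suc-injective))) ⟩
  g zero + (∑[ i < _ ] g (suc i) + f (suc x)) ≡⟨ +-assoc (g zero) _ _ ⟨
  g zero + ∑[ i < _ ] g (suc i) + f (suc x)   ∎
  where open ≡-Reasoning

length-filter-allFin : ∀ {n} {P : Fin n → Set} (P? : Decidable P) →
                       length (filter P? (allFin n)) ≡ ∑[ i < n ] (if does (P? i) then 1 else 0)
length-filter-allFin P? = length-filter-tabulate P? (λ i → i)
  where
  length-filter-tabulate : ∀ {A : Set} {n} {P : A → Set} (P? : Decidable P) (f : Fin n → A) →
                           length (filter P? (tabulate f)) ≡ ∑[ i < n ] (if does (P? (f i)) then 1 else 0)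
  length-filter-tabulate {n = zero}  P? f = refl
  length-filter-tabulate {n = suc n} P? f with does (P? (f zero))
  ... | true  = cong suc (length-filter-tabulate P? (f ∘ suc))
  ... | false = length-filter-tabulate P? (f ∘ suc)

module Completions (k′ : ℕ) where

  k : ℕ
  k = suc k′

  -- completions m u r is c(m, u, r) for k = suc k′.
  mutual
    completions : ℕ → ℕ → ℕ → ℕ
    completions zero    zero    zero    = 1
    completions zero    zero    (suc _) = 0
    completions zero    (suc _) _       = 0
    completions (suc m) u       r       = u * completions m (pred u) (r + k′) + topCompletions m u r

    topCompletions : ℕ → ℕ → ℕ → ℕ
    topCompletions m u zero    = 0
    topCompletions m u (suc r) = completions m u r

  completions-unopened : ∀ r → completions r 0 r ≡ 1
  completions-unopened zero    = refl
  completions-unopened (suc r) = completions-unopened r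

  exactCompletions : ℕ → ℕ → ℕ
  exactCompletions u r = completions (k * u + r) u r

  exactCompletions-unopened : ∀ r → exactCompletions 0 r ≡ 1
  exactCompletions-unopened r rewrite *-zeroʳ k′ = completions-unopened r

  exactCompletions-open : ∀ u → exactCompletions (suc u) 0 ≡ suc u * exactCompletions u k′
  exactCompletions-open u = begin
    completions (k * suc u + 0) (suc u) 0 ≡⟨ cong (λ m → completions m (suc u) 0) (length≡ k′ u) ⟩
    suc u * exactCompletions u k′ + 0     ≡⟨ +-identityʳ _ ⟩
    suc u * exactCompletions u k′         ∎
    where
    open ≡-Reasoning
    length≡ : ∀ k′ u → suc k′ * suc u + 0 ≡ suc (suc k′ * u + k′)
    length≡ = solve-∀

  exactCompletions-pop : ∀ u r → exactCompletions (suc u) (suc r) ≡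
                                 suc u * exactCompletions u (suc r + k′) + exactCompletions (suc u) r
  exactCompletions-pop u r = begin
    completions (k * suc u + suc r) (suc u) (suc r)
      ≡⟨ cong (λ m → completions m (suc u) (suc r)) (+-suc (k * suc u) r) ⟩
    suc u * completions (k * suc u + r) u (suc r + k′) + exactCompletions (suc u) r
      ≡⟨ cong (λ m → suc u * completions m u (suc r + k′) + exactCompletions (suc u) r) (length≡ k′ u r) ⟩
    suc u * exactCompletions u (suc r + k′) + exactCompletions (suc u) r ∎
    where
    open ≡-Reasoning
    length≡ : ∀ k′ u r → suc k′ * suc u + r ≡ suc k′ * u + (suc r + k′)
    length≡ = solve-∀

  exactCompletions-closed : ∀ u r → exactCompletions u r * (suc (k′ * u + r)) ! ≡ suc r * (k * u + r) !
  exactCompletions-closed zero r rewrite exactCompletions-unopened r | *-zeroʳ k′ = *-identityˡ _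
  exactCompletions-closed (suc u) zero = begin
    exactCompletions (suc u) 0 * (suc (k′ * suc u + 0)) !
      ≡⟨ cong₂ (λ t a → t * (suc a) !) (exactCompletions-open u) (index≡ k′ u) ⟩
    suc u * exactCompletions u k′ * (suc (k′ * u + k′)) !
      ≡⟨ *-assoc (suc u) (exactCompletions u k′) _ ⟩
    suc u * (exactCompletions u k′ * (suc (k′ * u + k′)) !)
      ≡⟨ cong (suc u *_) (exactCompletions-closed u k′) ⟩
    suc u * (suc k′ * (k * u + k′) !)
      ≡⟨ regroup k′ u _ ⟩
    suc (k * u + k′) * (k * u + k′) !
      ≡⟨ cong _! (length≡ k′ u) ⟨
    (k * suc u + 0) !
      ≡⟨ *-identityˡ _ ⟨
    1 * (k * suc u + 0) ! ∎
    where
    open ≡-Reasoning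
    index≡ : ∀ k′ u → k′ * suc u + 0 ≡ k′ * u + k′
    index≡ = solve-∀
    regroup : ∀ k′ u f → suc u * (suc k′ * f) ≡ suc (suc k′ * u + k′) * f
    regroup = solve-∀
    length≡ : ∀ k′ u → suc k′ * suc u + 0 ≡ suc (suc k′ * u + k′)
    length≡ = solve-∀
  exactCompletions-closed (suc u) (suc r) = begin
    exactCompletions (suc u) (suc r) * (suc (k′ * suc u + suc r)) !
      ≡⟨ cong₂ (λ t a → t * a !) (exactCompletions-pop u r) (+-suc (suc (k′ * suc u)) r) ⟩
    (suc u * X + Y) * (suc (suc a) * (suc a) !)
      ≡⟨ distribute (suc u) X Y (suc (suc a)) ((suc a) !) ⟩
    suc u * (X * (suc (suc a)) !) + suc (suc a) * (Y * (suc a) !)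
      ≡⟨ cong₂ (λ p q → suc u * p + suc (suc a) * q) X-closed (exactCompletions-closed (suc u) r) ⟩
    suc u * (suc (suc r + k′) * L !) + suc (suc a) * (suc r * L !)
      ≡⟨ key-identity k′ u r (L !) ⟩
    suc (suc r) * (suc L * L !)
      ≡⟨ cong (λ m → suc (suc r) * m !) (+-suc (k * suc u) r) ⟨
    suc (suc r) * (k * suc u + suc r) ! ∎
    where
    open ≡-Reasoning
    X = exactCompletions u (suc r + k′)
    Y = exactCompletions (suc u) r
    a = k′ * suc u + r
    L = k * suc u + r
    distribute : ∀ s x y b c → (s * x + y) * (b * c) ≡ s * (x * (b * c)) + b * (y * c)
    distribute = solve-∀
    X-closed : X * (suc (suc a)) ! ≡ suc (suc r + k′) * L !
    X-closed = begin
      X * (suc (suc a)) !                         ≡⟨ cong (λ m → X * (suc m) !) (index≡ k′ u r) ⟨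
      X * (suc (k′ * u + (suc r + k′))) !         ≡⟨ exactCompletions-closed u (suc r + k′) ⟩
      suc (suc r + k′) * (k * u + (suc r + k′)) ! ≡⟨ cong (λ m → suc (suc r + k′) * m !) (length≡ k′ u r) ⟩
      suc (suc r + k′) * L !                      ∎
      where
      index≡ : ∀ k′ u r → k′ * u + (suc r + k′) ≡ suc (k′ * suc u + r)
      index≡ = solve-∀
      length≡ : ∀ k′ u r → suc k′ * u + (suc r + k′) ≡ suc k′ * suc u + r
      length≡ = solve-∀
    key-identity : ∀ k′ u r f → suc u * (suc (suc r + k′) * f) + suc (suc (k′ * suc u + r)) * (suc r * f)
                               ≡ suc (suc r) * (suc (suc k′ * suc u + r) * f)
    key-identity = solve-∀

factorials*binomial : ∀ {m j} → j ≤ m → (j ! * (m ∸ j) !) * (m C j) ≡ m !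
factorials*binomial {m} {j} j≤m =
  trans (cong (j ! * (m ∸ j) ! *_) (nCk≡n!/k![n-k]! j≤m)) (m*[n/m]≡n {{j !* (m ∸ j) !≢0}} (k![n∸k]!∣n! j≤m))

module StackWords (n k : ℕ) where

  open Occurrences (Fin._≟_ {n}) public

  Full : List (Fin n) → Fin n → Set
  Full P i = occurrences i P ≡ k

  Complete : List (Fin n) → Set
  Complete P = ∀ i → Full P i

  top : List (Fin n) → Maybe (Fin n)
  top P = findLast (λ i → ¬? (occurrences i P ℕ.≟ k)) P

  Allowed : List (Fin n) → Fin n → Set
  Allowed P x = occurrences x P ≡ 0 ⊎ top P ≡ just x

  Accepts : List (Fin n) → List (Fin n) → Set
  Accepts P []      = Complete P
  Accepts P (x ∷ w) = Allowed P x × Accepts (P ++ [ x ]) w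

  top-just : ∀ {P x} → top P ≡ just x →
             ∃₂ λ s t → P ≡ s ++ x ∷ t × ¬ Full P x × (∀ {y} → y ∈ t → Full P y)
  top-just {P} top≡x =
    let s , t , P≡ , ¬full-x , t-full = findLast-just (λ i → ¬? (occurrences i P ℕ.≟ k)) top≡x
    in s , t , P≡ , ¬full-x , λ y∈t → decidable-stable (occurrences _ P ℕ.≟ k) (All.lookup t-full y∈t)

  top-nothing : ∀ {P} → top P ≡ nothing → ∀ {y} → y ∈ P → Full P y
  top-nothing {P} top≡nothing y∈P =
    decidable-stable (occurrences _ P ℕ.≟ k)
                     (All.lookup (findLast-nothing (λ i → ¬? (occurrences i P ℕ.≟ k)) top≡nothing) y∈P)

  top∈ : ∀ {P x} → top P ≡ just x → x ∈ P
  top∈ {P} top≡x = let s , _ , P≡ , _ = top-just {P} top≡x in subst (_ ∈_) (sym P≡) (∈-++⁺ʳ s (here refl))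

  complete-split : ∀ P {Q} → Complete (P ++ Q) → ∀ y → occurrences y P + occurrences y Q ≡ k
  complete-split P {Q} complete y = trans (sym (occurrences-++ y P Q)) (complete y)

  full-not-later : ∀ P {Q y} → Complete (P ++ Q) → Full P y → y ∉ Q
  full-not-later P {Q} {y} complete full y∈Q =
    ∈⇒occurrences≢0 y∈Q (+-cancelˡ-≡ k _ 0 (begin
      k + occurrences y Q                ≡⟨ cong (_+ occurrences y Q) full ⟨
      occurrences y P + occurrences y Q  ≡⟨ complete-split P complete y ⟩
      k                                  ≡⟨ +-identityʳ k ⟨
      k + 0                              ∎))
    where open ≡-Reasoning

  unfull-later : ∀ P {Q y} → Complete (P ++ Q) → ¬ Full P y → y ∈ Q
  unfull-later P {Q} {y} complete ¬full = occurrences≢0⇒∈ Q λ occ≡0 → ¬full (begin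
    occurrences y P                    ≡⟨ +-identityʳ _ ⟨
    occurrences y P + 0                ≡⟨ cong (occurrences y P +_) occ≡0 ⟨
    occurrences y P + occurrences y Q  ≡⟨ complete-split P complete y ⟩
    k                                  ∎)
    where open ≡-Reasoning

  accepts⇒complete : ∀ P w → Accepts P w → Complete (P ++ w)
  accepts⇒complete P []      complete  = subst Complete (sym (++-identityʳ P)) complete
  accepts⇒complete P (x ∷ w) (_ , acc) = subst Complete (++-assoc P [ x ] w) (accepts⇒complete (P ++ [ x ]) w acc)

  accepts⇒allowed : ∀ P Q {x R} → Accepts P (Q ++ x ∷ R) → Allowed (P ++ Q) x
  accepts⇒allowed P []      (allowed , _) = subst (λ P′ → Allowed P′ _) (sym (++-identityʳ P)) allowed
  accepts⇒allowed P (y ∷ Q) (_ , acc)     =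
    subst (λ P′ → Allowed P′ _) (++-assoc P [ y ] Q) (accepts⇒allowed (P ++ [ y ]) Q acc)

  -- x can return only as the top, so every letter written since its last occurrence is full.
  revisit-closes : ∀ L {x y} s Q → x ∈ L → x ∉ y ∷ s → Accepts [] ((L ++ y ∷ s) ++ x ∷ Q) → y ∉ Q
  revisit-closes L {x} {y} s Q x∈L x∉y∷s acc with accepts⇒allowed [] (L ++ y ∷ s) acc
  ... | inj₁ fresh = ⊥-elim (∈⇒occurrences≢0 (∈-++⁺ˡ x∈L) fresh)
  ... | inj₂ top≡x =
    let s′ , t′ , P≡ , _ , t′-full = top-just top≡x
        c′ , t′≡ = occurrence-before-suffix L s′ x∉y∷s P≡
        y-full = t′-full (subst (y ∈_) (sym t′≡) (∈-++⁺ʳ c′ (here refl)))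
    in full-not-later (L ++ y ∷ s) (accepts⇒complete [] _ acc) y-full ∘ there

  accepts⇒abab-free : ∀ W → Accepts [] W → ¬ HasABAB W
  accepts⇒abab-free _ acc (abab {x} {y} p₁ p₂ p₃ p₄ p₅ x≢y refl) =
    -- the first x after the y returns to x with the y still unfinished
    let s , c , p₃≡ , x∉s = first-occurrence Fin._≟_ p₃ (p₄ ++ y ∷ p₅)
    in revisit-closes (p₁ ++ x ∷ p₂) s _ (∈-++⁺ʳ p₁ (here refl)) (x∉y∷ s x∉s)
         (subst (Accepts []) (regroup s p₃≡) acc) (∈-++⁺ʳ c (∈-++⁺ʳ p₄ (here refl)))
    where
    regroup : ∀ s {q r} → q ≡ s ++ r → p₁ ++ x ∷ p₂ ++ y ∷ q ≡ ((p₁ ++ x ∷ p₂) ++ y ∷ s) ++ r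
    regroup s refl = trans (sym (++-assoc p₁ (x ∷ p₂) _)) (sym (++-assoc (p₁ ++ x ∷ p₂) (y ∷ s) _))
    x∉y∷ : ∀ s → x ∉ s → x ∉ y ∷ s
    x∉y∷ s x∉s (here x≡y)  = x≢y x≡y
    x∉y∷ s x∉s (there x∈s) = x∉s x∈s

  -- The word then reads … x … z … x … z …, as x lies below the unfinished top z.
  opened-below-top : ∀ P {x z} w → Complete (P ++ x ∷ w) → occurrences x P ≢ 0 → top P ≡ just z → z ≢ x →
                     HasABAB (P ++ x ∷ w)
  opened-below-top P {x} {z} w complete opened top≡z z≢x
    with s , t , refl , ¬full-z , t-full ← top-just {P} top≡z
    with ∈-++⁻ s (occurrences≢0⇒∈ (s ++ z ∷ t) opened)
  ... | inj₂ (here x≡z)  = ⊥-elim (z≢x (sym x≡z))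
  ... | inj₂ (there x∈t) = ⊥-elim (full-not-later (s ++ z ∷ t) complete (t-full x∈t) (here refl))
  ... | inj₁ x∈s with ∈-∃++ x∈s | unfull-later (s ++ z ∷ t) complete ¬full-z
  ...   | _ , _ , refl | here z≡x = ⊥-elim (z≢x z≡x)
  ...   | s₁ , s₂ , refl | there z∈w with w₁ , w₂ , refl ← ∈-∃++ z∈w =
    abab s₁ s₂ t w₁ w₂ (z≢x ∘ sym) (trans (++-assoc (s₁ ++ x ∷ s₂) (z ∷ t) _) (++-assoc s₁ (x ∷ s₂) _))

  abab-free⇒allowed : ∀ P {x} w → Complete (P ++ x ∷ w) → ¬ HasABAB (P ++ x ∷ w) → Allowed P x
  abab-free⇒allowed P {x} w complete abab-free with occurrences x P ℕ.≟ 0 | top P in top≡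
  ... | yes fresh | _       = inj₁ fresh
  ... | no opened | nothing =
    ⊥-elim (full-not-later P complete (top-nothing top≡ (occurrences≢0⇒∈ P opened)) (here refl))
  ... | no opened | just z with z Fin.≟ x
  ...   | yes refl = inj₂ refl
  ...   | no z≢x   = ⊥-elim (abab-free (opened-below-top P w complete opened top≡ z≢x))

  abab-free⇒accepts : ∀ P w → Complete (P ++ w) → ¬ HasABAB (P ++ w) → Accepts P w
  abab-free⇒accepts P []      complete _         = subst Complete (++-identityʳ P) complete
  abab-free⇒accepts P (x ∷ w) complete abab-free =
    abab-free⇒allowed P w complete abab-free ,
    abab-free⇒accepts (P ++ [ x ]) w (subst Complete (sym assoc) complete) (abab-free ∘ subst HasABAB assoc)
    where assoc = ++-assoc P [ x ] w

module Enumeration (n k : ℕ) where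

  open StackWords n k

  complete? : ∀ P → Dec (Complete P)
  complete? P = Fin.all? (λ i → occurrences i P ℕ.≟ k)

  fresh? : ∀ P → Decidable (λ i → occurrences i P ≡ 0)
  fresh? P i = occurrences i P ℕ.≟ 0

  candidates : List (Fin n) → List (Fin n)
  candidates P = filter (fresh? P) (allFin n) ++ fromMaybe (top P)

  ∈-candidates⁻ : ∀ P {x} → x ∈ candidates P → Allowed P x
  ∈-candidates⁻ P x∈ with ∈-++⁻ (filter (fresh? P) (allFin n)) x∈
  ... | inj₁ x∈fresh = inj₁ (proj₂ (∈-filter⁻ (fresh? P) {xs = allFin n} x∈fresh))
  ... | inj₂ x∈top   = inj₂ (∈-fromMaybe⁻ x∈top)

  ∈-candidates⁺ : ∀ P {x} → Allowed P x → x ∈ candidates P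
  ∈-candidates⁺ P (inj₁ fresh) = ∈-++⁺ˡ (∈-filter⁺ (fresh? P) (∈-allFin _) fresh)
  ∈-candidates⁺ P (inj₂ top≡x) = ∈-++⁺ʳ _ (subst (λ mx → _ ∈ fromMaybe mx) (sym top≡x) (here refl))

  candidates-unique : ∀ P → Unique (candidates P)
  candidates-unique P =
    Unique.++⁺ (Unique.filter⁺ (fresh? P) (Unique.allFin⁺ n)) (fromMaybe-unique (top P)) fresh-not-top
    where
    fresh-not-top : Disjoint (filter (fresh? P) (allFin n)) (fromMaybe (top P))
    fresh-not-top (x∈fresh , x∈top) =
      ∈⇒occurrences≢0 (top∈ {P} (∈-fromMaybe⁻ x∈top)) (proj₂ (∈-filter⁻ (fresh? P) {xs = allFin n} x∈fresh))

  accepted : ∀ m → List (Fin n) → List (Vec (Fin n) m)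
  accepted zero P with complete? P
  ... | yes _ = [ Vec.[] ]
  ... | no _  = []
  accepted (suc m) P = prefixed (λ x → accepted m (P ++ [ x ])) (candidates P)

  accepted⇒accepts : ∀ m P (v : Vec (Fin n) m) → v ∈ accepted m P → Accepts P (toList v)
  accepted⇒accepts zero P Vec.[] v∈ with complete? P
  accepted⇒accepts zero P Vec.[] _  | yes complete = complete
  accepted⇒accepts zero P Vec.[] () | no _
  accepted⇒accepts (suc m) P (x Vec.∷ v) v∈ =
    let x∈ , v∈′ = ∈-prefixed⁻ _ (candidates P) v∈ in ∈-candidates⁻ P x∈ , accepted⇒accepts m (P ++ [ x ]) v v∈′

  accepts⇒accepted : ∀ m P (v : Vec (Fin n) m) → Accepts P (toList v) → v ∈ accepted m P
  accepts⇒accepted zero P Vec.[] complete with complete? P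
  ... | yes _         = here refl
  ... | no incomplete = ⊥-elim (incomplete complete)
  accepts⇒accepted (suc m) P (x Vec.∷ v) (allowed , acc) =
    ∈-prefixed⁺ _ (∈-candidates⁺ P allowed) (accepts⇒accepted m (P ++ [ x ]) v acc)

  accepted-unique : ∀ m P → Unique (accepted m P)
  accepted-unique zero P with complete? P
  ... | yes _ = [] ∷ []
  ... | no _  = []
  accepted-unique (suc m) P = prefixed-unique _ (candidates-unique P) (λ x → accepted-unique m (P ++ [ x ]))

module Counting (n k′ : ℕ) where

  open StackWords n (suc k′)
  open Enumeration n (suc k′)
  open Completions k′ using (completions; topCompletions)

  Bounded : List (Fin n) → Set
  Bounded P = ∀ i → occurrences i P ≤ suc k′

  unopened : ℕ → ℕ
  unopened c = if does (c ℕ.≟ 0) then 1 else 0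

  pending : ℕ → ℕ
  pending zero    = 0
  pending (suc c) = k′ ∸ c

  tally : (ℕ → ℕ) → List (Fin n) → ℕ
  tally φ P = ∑[ i < n ] φ (occurrences i P)

  tally-snoc : ∀ φ P x {c} → occurrences x P ≡ c → tally φ (P ++ [ x ]) + φ c ≡ tally φ P + φ (suc c)
  tally-snoc φ P x refl =
    trans (∑-update (λ i → φ (occurrences i (P ++ [ x ]))) (λ i → φ (occurrences i P)) x
                    (λ i i≢x → cong φ (occurrences-snoc-other P (i≢x ∘ sym))))
          (cong (λ c → tally φ P + φ c) (occurrences-snoc-self x P))

  opening-step : ∀ P x → occurrences x P ≡ 0 →
                 tally unopened P ≡ suc (tally unopened (P ++ [ x ])) ×
                 tally pending (P ++ [ x ]) ≡ tally pending P + k′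
  opening-step P x fresh =
    trans (sym (+-identityʳ _)) (trans (sym (tally-snoc unopened P x fresh)) (+-comm _ 1)) ,
    trans (sym (+-identityʳ _)) (tally-snoc pending P x fresh)

  repeat-step : ∀ P x {c} → occurrences x P ≡ suc c → c < k′ →
                tally unopened (P ++ [ x ]) ≡ tally unopened P ×
                tally pending P ≡ suc (tally pending (P ++ [ x ]))
  repeat-step P x {c} opened c<k′ =
    +-cancelʳ-≡ 0 _ _ (tally-snoc unopened P x opened) ,
    +-cancelʳ-≡ (k′ ∸ suc c) _ _ (begin
      tally pending P + (k′ ∸ suc c)             ≡⟨ tally-snoc pending P x opened ⟨
      tally pending (P ++ [ x ]) + (k′ ∸ c)      ≡⟨ cong (tally pending (P ++ [ x ]) +_) (+-∸-assoc 1 c<k′) ⟩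
      tally pending (P ++ [ x ]) + suc (k′ ∸ suc c) ≡⟨ +-suc _ _ ⟩
      suc (tally pending (P ++ [ x ])) + (k′ ∸ suc c) ∎)
    where open ≡-Reasoning

  complete⇒tallies≡0 : ∀ P → Complete P → tally unopened P ≡ 0 × tally pending P ≡ 0
  complete⇒tallies≡0 P complete =
    ∑-zero _ (λ i → cong unopened (complete i)) , ∑-zero _ (λ i → trans (cong pending (complete i)) (n∸n≡0 k′))

  tallies≡0⇒complete : ∀ P → Bounded P → tally unopened P ≡ 0 → tally pending P ≡ 0 → Complete P
  tallies≡0⇒complete P bounded u≡0 p≡0 i =
    closed (occurrences i P) (∑≡0⇒≡0 _ u≡0 i) (∑≡0⇒≡0 _ p≡0 i) (bounded i)
    where
    closed : ∀ c → unopened c ≡ 0 → pending c ≡ 0 → c ≤ suc k′ → c ≡ suc k′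
    closed (suc c) _ k′∸c≡0 (s≤s c≤k′) = cong suc (≤-antisym c≤k′ (m∸n≡0⇒m≤n k′∸c≡0))

  no-top⇒no-pending : ∀ P → top P ≡ nothing → tally pending P ≡ 0
  no-top⇒no-pending P top≡nothing =
    ∑-zero _ (λ i → settled (occurrences i P) (top-nothing top≡nothing ∘ occurrences≢0⇒∈ P))
    where
    settled : ∀ c → (c ≢ 0 → c ≡ suc k′) → pending c ≡ 0
    settled zero    _    = refl
    settled (suc c) full = trans (cong (k′ ∸_) (suc-injective (full λ ()))) (n∸n≡0 k′)

  allowed⇒below-bound : ∀ P {x} → Bounded P → Allowed P x → occurrences x P < suc k′
  allowed⇒below-bound P {x} bounded (inj₁ fresh) = subst (_< suc k′) (sym fresh) (s≤s z≤n)
  allowed⇒below-bound P {x} bounded (inj₂ top≡x) =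
    let _ , _ , _ , ¬full , _ = top-just {P} top≡x in ≤∧≢⇒< (bounded x) ¬full

  bounded-step : ∀ P {x} → Bounded P → Allowed P x → Bounded (P ++ [ x ])
  bounded-step P {x} bounded allowed i with x Fin.≟ i
  ... | yes refl = subst (_≤ suc k′) (sym (occurrences-snoc-self x P)) (allowed⇒below-bound P bounded allowed)
  ... | no x≢i   = subst (_≤ suc k′) (sym (occurrences-snoc-other P x≢i)) (bounded i)

  length-accepted : ∀ m P → Bounded P → length (accepted m P) ≡ completions m (tally unopened P) (tally pending P)
  length-accepted zero P bounded with complete? P
  ... | yes complete = let u≡0 , p≡0 = complete⇒tallies≡0 P complete in sym (cong₂ (completions 0) u≡0 p≡0)
  ... | no incomplete with tally unopened P in u≡ | tally pending P in p≡
  ...   | zero  | zero  = ⊥-elim (incomplete (tallies≡0⇒complete P bounded u≡ p≡))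
  ...   | zero  | suc _ = refl
  ...   | suc _ | _     = refl
  length-accepted (suc m) P bounded = begin
    length (prefixed extend (freshLetters ++ fromMaybe (top P)))
      ≡⟨ cong length (concatMap-++ _ freshLetters (fromMaybe (top P))) ⟩
    length (prefixed extend freshLetters ++ prefixed extend (fromMaybe (top P)))
      ≡⟨ length-++ (prefixed extend freshLetters) ⟩
    length (prefixed extend freshLetters) + length (prefixed extend (fromMaybe (top P)))
      ≡⟨ cong₂ _+_ openings (repeats (top P) refl) ⟩
    completions (suc m) (tally unopened P) (tally pending P) ∎
    where
    open ≡-Reasoning
    extend = λ x → accepted m (P ++ [ x ])
    freshLetters = filter (fresh? P) (allFin n)

    length-extend : ∀ {x} → Allowed P x →
                    length (extend x) ≡ completions m (tally unopened (P ++ [ x ])) (tally pending (P ++ [ x ]))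
    length-extend allowed = length-accepted m (P ++ [ _ ]) (bounded-step P bounded allowed)

    openings : length (prefixed extend freshLetters) ≡
               tally unopened P * completions m (pred (tally unopened P)) (tally pending P + k′)
    openings = trans (length-prefixed extend freshLetters opening)
                     (cong (_* completions m (pred (tally unopened P)) (tally pending P + k′))
                           (length-filter-allFin (fresh? P)))
      where
      opening : ∀ {x} → x ∈ freshLetters →
                length (extend x) ≡ completions m (pred (tally unopened P)) (tally pending P + k′)
      opening {x} x∈freshLetters =
        let x-freshLetters = proj₂ (∈-filter⁻ (fresh? P) {xs = allFin n} x∈freshLetters)
            u≡ , p≡ = opening-step P x x-freshLetters
        in trans (length-extend (inj₁ x-freshLetters)) (cong₂ (completions m) (cong pred (sym u≡)) p≡)

    repeats : ∀ t? → top P ≡ t? →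
              length (prefixed extend (fromMaybe t?)) ≡ topCompletions m (tally unopened P) (tally pending P)
    repeats nothing  top≡nothing = sym (cong (topCompletions m (tally unopened P)) (no-top⇒no-pending P top≡nothing))
    repeats (just t) top≡t with occurrences t P in t-count
    ... | zero  = ⊥-elim (∈⇒occurrences≢0 (top∈ {P} top≡t) t-count)
    ... | suc c =
      let c<k′ = s≤s⁻¹ (subst (_< suc k′) t-count (allowed⇒below-bound P bounded (inj₂ top≡t)))
          u≡ , p≡ = repeat-step P t t-count c<k′
      in begin
        length (prefixed extend (t ∷ []))
          ≡⟨ trans (length-prefixed extend (t ∷ []) (λ { (here refl) → refl })) (*-identityˡ _) ⟩
        length (extend t)
          ≡⟨ length-extend (inj₂ top≡t) ⟩
        completions m (tally unopened (P ++ [ t ])) (tally pending (P ++ [ t ]))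
          ≡⟨ cong (λ u → completions m u (tally pending (P ++ [ t ]))) u≡ ⟩
        topCompletions m (tally unopened P) (suc (tally pending (P ++ [ t ])))
          ≡⟨ cong (topCompletions m (tally unopened P)) p≡ ⟨
        topCompletions m (tally unopened P) (tally pending P) ∎

module Qbar (n k′ : ℕ) where

  open StackWords n (suc k′)
  open Enumeration n (suc k′)
  open Counting n k′
  open Completions k′ using (k; completions; exactCompletions; exactCompletions-closed)

  inQbar⇔accepts : ∀ (w : Word n k) → InQbar n k w ⇔ Accepts [] (toList w)
  inQbar⇔accepts w = mk⇔
    (λ (perm , avoids) → abab-free⇒accepts [] (toList w)
                           (λ i → trans (sym (count≡length∘filter _ w)) (perm i)) (avoids ∘ hasABAB⇒contains w))
    (λ acc → (λ i → trans (count≡length∘filter _ w) (accepts⇒complete [] _ acc i)) ,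
             accepts⇒abab-free _ acc ∘ contains⇒hasABAB w)

  size : ℕ
  size = length (accepted (k * n) [])

  size≡exactCompletions : size ≡ exactCompletions n 0
  size≡exactCompletions = begin
    size
      ≡⟨ length-accepted (k * n) [] (λ _ → z≤n) ⟩
    completions (k * n) (tally unopened []) (tally pending [])
      ≡⟨ cong₂ (completions (k * n)) all-unopened (∑-zero {n} _ (λ _ → refl)) ⟩
    completions (k * n) n 0
      ≡⟨ cong (λ m → completions m n 0) (+-identityʳ (k * n)) ⟨
    exactCompletions n 0 ∎
    where
    open ≡-Reasoning
    all-unopened : tally unopened [] ≡ n
    all-unopened = trans (∑-const n 1) (*-identityʳ n)

  size*factorial : size * (suc (k′ * n)) ! ≡ (k * n) !
  size*factorial = begin
    size * (suc (k′ * n)) !                     ≡⟨ cong₂ (λ t a → t * (suc a) !) size≡exactCompletions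
                                                         (sym (+-identityʳ (k′ * n))) ⟩
    exactCompletions n 0 * (suc (k′ * n + 0)) ! ≡⟨ exactCompletions-closed n 0 ⟩
    1 * (k * n + 0) !                           ≡⟨ trans (*-identityˡ _) (cong _! (+-identityʳ (k * n))) ⟩
    (k * n) !                                   ∎
    where open ≡-Reasoning

  size*[k′n+1]≡n!*binomial : size * suc (k′ * n) ≡ n ! * ((k * n) C n)
  size*[k′n+1]≡n!*binomial = *-cancelʳ-≡ _ _ ((k′ * n) !) {{(k′ * n) !≢0}} (begin
    size * suc (k′ * n) * (k′ * n) !    ≡⟨ *-assoc size _ _ ⟩
    size * (suc (k′ * n)) !             ≡⟨ size*factorial ⟩
    (k * n) !                           ≡⟨ factorials*binomial (m≤m+n n (k′ * n)) ⟨
    n ! * (k * n ∸ n) ! * ((k * n) C n) ≡⟨ cong (λ a → n ! * a ! * ((k * n) C n)) (m+n∸m≡n n (k′ * n)) ⟩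
    n ! * (k′ * n) ! * ((k * n) C n)    ≡⟨ swap-last (n !) _ _ ⟩
    n ! * ((k * n) C n) * (k′ * n) !    ∎)
    where
    open ≡-Reasoning
    swap-last : ∀ a b c → a * b * c ≡ a * c * b
    swap-last = solve-∀

theorem4p3 : ∀ (n k : ℕ) → n ≥ 1 → k ≥ 1 →
    ∃[ xs ] (Unique xs × (∀ (w : Word n k) → (w ∈ xs ⇔ InQbar n k w)) ×
      length xs * (((k ∸ 1) * n + 1) !) ≡ (k * n) ! ×
      length xs * ((k ∸ 1) * n + 1) ≡ (n !) * ((k * n) C n))
theorem4p3 n zero    _ ()
theorem4p3 n (suc k′) _ _ =
  accepted (suc k′ * n) [] ,
  accepted-unique (suc k′ * n) [] ,
  (λ w → ⇔-trans (mk⇔ (accepted⇒accepts _ [] w) (accepts⇒accepted _ [] w)) (⇔-sym (inQbar⇔accepts w))) ,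
  trans (cong (λ a → size * a !) (+-comm (k′ * n) 1)) size*factorial ,
  trans (cong (size *_) (+-comm (k′ * n) 1)) size*[k′n+1]≡n!*binomial
  where
  open Enumeration n (suc k′)
  open Qbar n k′
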